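{- For every 3-partite 3-graph $H$ with $R'_2(H)\geq t(H)+1$, we have $f'(H,\mathcal{L})=R'_2(H)$.
   Context: $K^{(3)}_{t,t,t}$ is the complete 3-partite 3-graph with three parts of size $t$. $t(H)$ is the minimum $t$ with $H\subseteq K^{(3)}_{t,t,t}$. $R'_2(H)$ is the minimum $n$ such that every 2-edge-coloring of $K^{(3)}_{n,n,n}$ contains a monochromatic copy of $H$; $f'(H,G)$ is the minimum $n$ such that every edge-coloring of $K^{(3)}_{n,n,n}$ with any number of colors contains a monochromatic copy of $H$ or a rainbow copy of $G$ (edges of pairwise distinct colors). The loose path $\mathcal{L}$ has edges $\{v_1v_2v_3,v_3v_4v_5,v_5v_6v_7\}$. -}

module Defs where

open import Data.Nat using (ℕ; _≤_; _+_)
open import Data.Fin using (Fin; zero; suc; _≟_)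
open import Data.Product using (Σ; _×_; _,_; proj₁; proj₂; ∃)
open import Data.Sum using (_⊎_)
open import Relation.Nullary using (yes; no)
open import Relation.Binary.PropositionalEquality using (_≡_; _≢_)
open import Function.Definitions using (Injective)

record 3Graph : Set where
  field
    nV   : ℕ
    nE   : ℕ
    edge : Fin nE → Fin nV × Fin nV × Fin nV
open 3Graph public

Is3Partite : 3Graph → Set
Is3Partite H = Σ (Fin (nV H) → Fin 3) λ p → ∀ e →
  let (a , b , c) = edge H e in (p a ≢ p b) × (p b ≢ p c) × (p a ≢ p c)

-- Vertices of K^(3)_{n,n,n}: (part, index). Edges = transversal triples,
-- identified with Fin n × Fin n × Fin n (coordinate in part 0, 1, 2).
Vtx : ℕ → Set
Vtx n = Fin 3 × Fin n

Coloring : ℕ → Set → Set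
Coloring n A = Fin n → Fin n → Fin n → A

pick : ∀ {n} → Fin 3 → Vtx n → Vtx n → Vtx n → Fin n
pick i x y z with proj₁ x ≟ i
... | yes _ = proj₂ x
... | no _ with proj₁ y ≟ i
...   | yes _ = proj₂ y
...   | no _  = proj₂ z

record Copy (H : 3Graph) (n : ℕ) : Set where
  field
    emb  : Fin (nV H) → Vtx n
    inj  : Injective _≡_ _≡_ emb
    tran : ∀ e → let (a , b , c) = edge H e in
             (proj₁ (emb a) ≢ proj₁ (emb b)) × (proj₁ (emb b) ≢ proj₁ (emb c))
               × (proj₁ (emb a) ≢ proj₁ (emb c))
open Copy public

edgeColor : ∀ {H n A} → Coloring n A → Copy H n → Fin (nE H) → A
edgeColor {H} col φ e with edge H e
... | (a , b , c) =
  col (pick zero (emb φ a) (emb φ b) (emb φ c))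
      (pick (suc zero) (emb φ a) (emb φ b) (emb φ c))
      (pick (suc (suc zero)) (emb φ a) (emb φ b) (emb φ c))

MonoCopy : (H : 3Graph) {n : ℕ} {A : Set} → Coloring n A → Set
MonoCopy H {n} {A} col = Σ (Copy H n) λ φ → Σ A λ k → ∀ e → edgeColor col φ e ≡ k

RainbowCopy : (G : 3Graph) {n : ℕ} {A : Set} → Coloring n A → Set
RainbowCopy G {n} col = Σ (Copy G n) λ φ →
  ∀ e e' → e ≢ e' → edgeColor col φ e ≢ edgeColor col φ e'

IsLeast : (ℕ → Set) → ℕ → Set
IsLeast P m = P m × (∀ k → P k → m ≤ k)

-- H ⊆ K^(3)_{t,t,t}; t(H) is the least such t.
Fits : 3Graph → ℕ → Set
Fits H t = Copy H t

-- every 2-colouring of K^(3)_{n,n,n} has a monochromatic H; R'_2(H) is the least such n.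
Ramsey2 : 3Graph → ℕ → Set
Ramsey2 H n = (col : Coloring n (Fin 2)) → MonoCopy H col

-- every colouring (any number of colours; colours drawn from ℕ) of K^(3)_{n,n,n}
-- has a monochromatic H or a rainbow G; f'(H,G) is the least such n.
FR : 3Graph → 3Graph → ℕ → Set
FR H G n = (col : Coloring n ℕ) → MonoCopy H col ⊎ RainbowCopy G col

-- loose path: edges v1v2v3, v3v4v5, v5v6v7 (vertices 0..6)
edgeL : Fin 3 → Fin 7 × Fin 7 × Fin 7
edgeL zero             = (0F , 1F , 2F) where open import Data.Fin.Patterns
edgeL (suc zero)       = (2F , 3F , 4F) where open import Data.Fin.Patterns
edgeL (suc (suc zero)) = (4F , 5F , 6F) where open import Data.Fin.Patterns

LoosePath : 3Graph
LoosePath = record { nV = 7 ; nE = 3 ; edge = edgeL }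

module Submission where

-- A 2-colouring has no rainbow 𝓛, so f′(H,𝓛) ≥ R′₂(H). Conversely let n = R′₂(H); since t(H) ≤ 1
-- would give R′₂(H) ≤ t(H), we have n ≥ 3. Colour K⁽³⁾ₙ,ₙ,ₙ without a rainbow 𝓛: then the middle edge
-- of a loose path whose end edges differ in colour repeats one of their colours. Routing such paths
-- through auxiliary edges shows that, for disjoint edges x, y of different colours, every edge sharing
-- at most one vertex with each of them has the colour of x or of y, and that an edge of a third colour
-- sharing two vertices with y forces every edge disjoint from y to have the colour of x. Hence either
-- at most two colours occur, and R′₂(H) gives a monochromatic H, or all edges disjoint from some edge o
-- share one colour; as t(H) ≤ n − 1, a copy of K⁽³⁾ₜ,ₜ,ₜ avoiding the vertices of o then contains a
-- monochromatic H.

open import Defs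
open import Data.Nat as ℕ using (ℕ; _≤_; _<_; _+_; z≤n; s≤s)
open import Data.Nat.Properties using (+-comm; <⇒≱; ≤-refl)
open import Data.Fin using (Fin; suc; toℕ; punchIn; inject≤; _≟_)
open import Data.Fin.Patterns
open import Data.Fin.Properties
  using (any?; all?; ¬Fin0; punchOut-injective; punchIn-injective; punchInᵢ≢i; inject≤-injective)
open import Data.Vec.Functional using ([]; _∷_)
open import Data.Product using (∃; ∃₂; _×_; _,_; -,_; proj₁; proj₂)
open import Data.Product.Properties using (≡-dec)
open import Data.Sum using (_⊎_; inj₁; inj₂; [_,_]′; swap) renaming (map₁ to ⊎-map₁; map₂ to ⊎-map₂)
open import Data.Empty using (⊥; ⊥-elim)
open import Function using (_∘_; id)
open import Function.Definitions using (Injective)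
open import Relation.Nullary using (¬_; Dec; yes; no)
open import Relation.Nullary.Decidable
  using (map′; ¬?; _×-dec_; _⊎-dec_; _→-dec_; decidable-stable; toWitness)
open import Relation.Binary.Definitions using (DecidableEquality)
open import Relation.Binary.PropositionalEquality
  using (_≡_; _≢_; refl; sym; trans; cong; cong₂; subst; subst₂; ≢-sym)

Distinct₃ : {A : Set} → A → A → A → Set
Distinct₃ x y z = x ≢ y × y ≢ z × x ≢ z

distinct₃-reverse : ∀ {A : Set} {x y z : A} → Distinct₃ x y z → Distinct₃ z y x
distinct₃-reverse (x≢y , y≢z , x≢z) = ≢-sym y≢z , ≢-sym x≢y , ≢-sym x≢z

distinct₃-injective : ∀ {A : Set} {x y z : A} → Distinct₃ x y z → Injective _≡_ _≡_ (x ∷ y ∷ z ∷ [])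
distinct₃-injective _             {0F} {0F} _ = refl
distinct₃-injective (x≢y , _ , _) {0F} {1F} e = ⊥-elim (x≢y e)
distinct₃-injective (_ , _ , x≢z) {0F} {2F} e = ⊥-elim (x≢z e)
distinct₃-injective (x≢y , _ , _) {1F} {0F} e = ⊥-elim (x≢y (sym e))
distinct₃-injective _             {1F} {1F} _ = refl
distinct₃-injective (_ , y≢z , _) {1F} {2F} e = ⊥-elim (y≢z e)
distinct₃-injective (_ , _ , x≢z) {2F} {0F} e = ⊥-elim (x≢z (sym e))
distinct₃-injective (_ , y≢z , _) {2F} {1F} e = ⊥-elim (y≢z (sym e))
distinct₃-injective _             {2F} {2F} _ = refl

¬distinct₃-Fin2 : (x y z : Fin 2) → ¬ Distinct₃ x y z
¬distinct₃-Fin2 0F 0F _  (x≢y , _ , _) = x≢y refl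
¬distinct₃-Fin2 1F 1F _  (x≢y , _ , _) = x≢y refl
¬distinct₃-Fin2 0F 1F 0F (_ , _ , x≢z) = x≢z refl
¬distinct₃-Fin2 0F 1F 1F (_ , y≢z , _) = y≢z refl
¬distinct₃-Fin2 1F 0F 0F (_ , y≢z , _) = y≢z refl
¬distinct₃-Fin2 1F 0F 1F (_ , _ , x≢z) = x≢z refl

distinct₃-Fin3-remaining : ∀ {p q₁ q₂ q₃ : Fin 3} → Distinct₃ q₁ q₂ q₃ → q₁ ≢ p → q₂ ≢ p → q₃ ≡ p
distinct₃-Fin3-remaining {p} {q₁} {q₂} {q₃} (q₁≢q₂ , q₂≢q₃ , q₁≢q₃) q₁≢p q₂≢p with q₃ ≟ p
... | yes q₃≡p = q₃≡p
... | no q₃≢p  = ⊥-elim (¬distinct₃-Fin2 _ _ _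
  ( q₁≢q₂ ∘ punchOut-injective (≢-sym q₁≢p) (≢-sym q₂≢p)
  , q₂≢q₃ ∘ punchOut-injective (≢-sym q₂≢p) (≢-sym q₃≢p)
  , q₁≢q₃ ∘ punchOut-injective (≢-sym q₁≢p) (≢-sym q₃≢p) ))

fresh : ∀ {m} (a b : Fin (3 + m)) → ∃ λ c → c ≢ a × c ≢ b
fresh 0F            0F            = 1F , (λ ()) , (λ ())
fresh 0F            1F            = 2F , (λ ()) , (λ ())
fresh 0F            (suc (suc _)) = 1F , (λ ()) , (λ ())
fresh 1F            0F            = 2F , (λ ()) , (λ ())
fresh 1F            1F            = 0F , (λ ()) , (λ ())
fresh 1F            (suc (suc _)) = 0F , (λ ()) , (λ ())
fresh (suc (suc _)) 0F            = 1F , (λ ()) , (λ ())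
fresh (suc (suc _)) 1F            = 0F , (λ ()) , (λ ())
fresh (suc (suc _)) (suc (suc _)) = 0F , (λ ()) , (λ ())

pad : ∀ {m} (a b : Fin (3 + m)) → Fin 3 → Fin (3 + m)
pad a b = a ∷ b ∷ proj₁ (fresh a b) ∷ []

pad-injective : ∀ {m} {a b : Fin (3 + m)} → a ≢ b → Injective _≡_ _≡_ (pad a b)
pad-injective {a = a} {b} a≢b =
  distinct₃-injective (a≢b , ≢-sym (proj₂ (proj₂ (fresh a b))) , ≢-sym (proj₁ (proj₂ (fresh a b))))

module _ {A : Set} (_≟ᶜ_ : DecidableEquality A) where

  distinct₃? : (α β γ : A) → Dec (Distinct₃ α β γ)
  distinct₃? α β γ = ¬? (α ≟ᶜ β) ×-dec ¬? (β ≟ᶜ γ) ×-dec ¬? (α ≟ᶜ γ)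

  ¬distinct₃-middle : ∀ {α β γ : A} → ¬ Distinct₃ α β γ → α ≢ γ → β ≡ α ⊎ β ≡ γ
  ¬distinct₃-middle {α} {β} {γ} ¬distinct α≢γ with β ≟ᶜ α | β ≟ᶜ γ
  ... | yes β≡α | _       = inj₁ β≡α
  ... | no _    | yes β≡γ = inj₂ β≡γ
  ... | no β≢α  | no β≢γ  = ⊥-elim (¬distinct (≢-sym β≢α , β≢γ , α≢γ))

shared-alternative : ∀ {A : Set} {α β γ δ : A} → β ≢ γ → α ≡ δ ⊎ α ≡ β → α ≡ δ ⊎ α ≡ γ → α ≡ δ
shared-alternative _   (inj₁ α≡δ) _          = α≡δ
shared-alternative _   (inj₂ _)   (inj₁ α≡δ) = α≡δ
shared-alternative β≢γ (inj₂ α≡β) (inj₂ α≡γ) = ⊥-elim (β≢γ (trans (sym α≡β) α≡γ))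

-- An edge is the triple of its vertex indices in parts 0, 1 and 2, the argument order of a Coloring.
Edge : ℕ → Set
Edge n = Fin n × Fin n × Fin n

_at_ : ∀ {n} → Edge n → Fin 3 → Fin n
(x , _ , _) at 0F = x
(_ , y , _) at 1F = y
(_ , _ , z) at 2F = z

_∈ₑ_ : ∀ {n} → Vtx n → Edge n → Set
v ∈ₑ a = proj₂ v ≡ a at proj₁ v

_∉ₑ_ : ∀ {n} → Vtx n → Edge n → Set
v ∉ₑ a = ¬ v ∈ₑ a

tabulate : ∀ {n} → (Fin 3 → Fin n) → Edge n
tabulate f = f 0F , f 1F , f 2F

at-tabulate : ∀ {n} (P : Fin 3 → Fin n → Set) {f : Fin 3 → Fin n} →
              (∀ q → P q (f q)) → ∀ q → P q (tabulate f at q)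
at-tabulate P Pf 0F = Pf 0F
at-tabulate P Pf 1F = Pf 1F
at-tabulate P Pf 2F = Pf 2F

edge-ext : ∀ {n} {a b : Edge n} → (∀ q → a at q ≡ b at q) → a ≡ b
edge-ext a≗b = cong₂ _,_ (a≗b 0F) (cong₂ _,_ (a≗b 1F) (a≗b 2F))

colourOf : ∀ {n} {A : Set} → Coloring n A → Edge n → A
colourOf col (x , y , z) = col x y z

module _ {n : ℕ} where

  Disjoint : Edge n → Edge n → Set
  Disjoint a b = ∀ q → a at q ≢ b at q

  MeetsAt : Edge n → Edge n → Fin 3 → Set
  MeetsAt a b i = a at i ≡ b at i × (∀ q → q ≢ i → a at q ≢ b at q)

  Meets : Edge n → Edge n → Set
  Meets a b = ∃ (MeetsAt a b)

  Close : Edge n → Edge n → Set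
  Close a b = ∃ λ k → ∀ q → q ≢ k → a at q ≡ b at q

  Far : Edge n → Edge n → Set
  Far a b = Disjoint a b ⊎ Meets a b

  IsLoosePath : Edge n → Edge n → Edge n → Set
  IsLoosePath a b d = Meets a b × Meets b d × Disjoint a d

  disjoint-sym : ∀ {a b} → Disjoint a b → Disjoint b a
  disjoint-sym a∥b q = a∥b q ∘ sym

  meetsAt-sym : ∀ {a b i} → MeetsAt a b i → MeetsAt b a i
  meetsAt-sym (a≡b , a≁b) = sym a≡b , λ q q≢i → a≁b q q≢i ∘ sym

  close-sym : ∀ {a b} → Close a b → Close b a
  close-sym (k , a≡b) = k , λ q q≢k → sym (a≡b q q≢k)

  meetsAt₀ : ∀ {a b} → a at 0F ≡ b at 0F → a at 1F ≢ b at 1F → a at 2F ≢ b at 2F → MeetsAt a b 0F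
  meetsAt₀ e n₁ n₂ = e , λ { 0F 0≢0 → ⊥-elim (0≢0 refl) ; 1F _ → n₁ ; 2F _ → n₂ }

  meetsAt₁ : ∀ {a b} → a at 0F ≢ b at 0F → a at 1F ≡ b at 1F → a at 2F ≢ b at 2F → MeetsAt a b 1F
  meetsAt₁ n₀ e n₂ = e , λ { 0F _ → n₀ ; 1F 1≢1 → ⊥-elim (1≢1 refl) ; 2F _ → n₂ }

  meetsAt₂ : ∀ {a b} → a at 0F ≢ b at 0F → a at 1F ≢ b at 1F → a at 2F ≡ b at 2F → MeetsAt a b 2F
  meetsAt₂ n₀ n₁ e = e , λ { 0F _ → n₀ ; 1F _ → n₁ ; 2F 2≢2 → ⊥-elim (2≢2 refl) }

  classify : ∀ a b → Close a b ⊎ Far a b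
  classify a b with a at 0F ≟ b at 0F | a at 1F ≟ b at 1F | a at 2F ≟ b at 2F
  ... | yes e₀ | yes e₁ | _      = inj₁ (2F , λ { 0F _ → e₀ ; 1F _ → e₁ ; 2F 2≢2 → ⊥-elim (2≢2 refl) })
  ... | yes e₀ | no _   | yes e₂ = inj₁ (1F , λ { 0F _ → e₀ ; 1F 1≢1 → ⊥-elim (1≢1 refl) ; 2F _ → e₂ })
  ... | no _   | yes e₁ | yes e₂ = inj₁ (0F , λ { 0F 0≢0 → ⊥-elim (0≢0 refl) ; 1F _ → e₁ ; 2F _ → e₂ })
  ... | yes e₀ | no n₁  | no n₂  = inj₂ (inj₂ (-, meetsAt₀ e₀ n₁ n₂))
  ... | no n₀  | yes e₁ | no n₂  = inj₂ (inj₂ (-, meetsAt₁ n₀ e₁ n₂))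
  ... | no n₀  | no n₁  | yes e₂ = inj₂ (inj₂ (-, meetsAt₂ n₀ n₁ e₂))
  ... | no n₀  | no n₁  | no n₂  = inj₂ (inj₁ λ { 0F → n₀ ; 1F → n₁ ; 2F → n₂ })

  ¬close⇒far : ∀ {a b} → ¬ Close a b → Far a b
  ¬close⇒far {a} {b} ¬a≈b = [ ⊥-elim ∘ ¬a≈b , id ]′ (classify a b)

  close-close-¬disjoint : ∀ {r a b} → Close r a → Close r b → ¬ Disjoint a b
  close-close-¬disjoint (k , r≡a) (k′ , r≡b) a∥b with fresh {0} k k′
  ... | q , q≢k , q≢k′ = a∥b q (trans (sym (r≡a q q≢k)) (r≡b q q≢k′))

  disjoint-via-close : ∀ {r y z} (z≈y : Close z y) → Disjoint r y →
                       r at proj₁ z≈y ≢ z at proj₁ z≈y → Disjoint r z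
  disjoint-via-close (k , z≡y) r∥y r≢z q with q ≟ k
  ... | yes refl = r≢z
  ... | no q≢k   = λ r≡z → r∥y q (trans r≡z (z≡y q q≢k))

  rotate : Edge n → Edge n
  rotate (x , y , z) = y , z , x

  rotate-disjoint : ∀ {a b} → Disjoint a b → Disjoint (rotate a) (rotate b)
  rotate-disjoint a∥b 0F = a∥b 1F
  rotate-disjoint a∥b 1F = a∥b 2F
  rotate-disjoint a∥b 2F = a∥b 0F

  rotate-meetsAt : ∀ {a b} i → MeetsAt a b i → Meets (rotate a) (rotate b)
  rotate-meetsAt 0F (e , a≁b) = 2F , meetsAt₂ (a≁b 1F λ ()) (a≁b 2F λ ()) e
  rotate-meetsAt 1F (e , a≁b) = 0F , meetsAt₀ e (a≁b 2F λ ()) (a≁b 0F λ ())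
  rotate-meetsAt 2F (e , a≁b) = 1F , meetsAt₁ (a≁b 1F λ ()) e (a≁b 0F λ ())

  disjoint? : ∀ a b → Dec (Disjoint a b)
  disjoint? a b = all? λ q → ¬? (a at q ≟ b at q)

  meets? : ∀ a b → Dec (Meets a b)
  meets? a b = any? λ i → (a at i ≟ b at i) ×-dec all? λ q → ¬? (q ≟ i) →-dec ¬? (a at q ≟ b at q)

  isLoosePath? : ∀ a b d → Dec (IsLoosePath a b d)
  isLoosePath? a b d = meets? a b ×-dec meets? b d ×-dec disjoint? a d

  any-edge? : {P : Edge n → Set} → (∀ a → Dec (P a)) → Dec (∃ P)
  any-edge? P? = map′ (λ (x , y , z , p) → (x , y , z) , p) (λ ((x , y , z) , p) → x , y , z , p)
                      (any? λ x → any? λ y → any? λ z → P? (x , y , z))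

fresh-edge : ∀ {m} (a b : Edge (3 + m)) → ∃ λ u → Disjoint u a × Disjoint u b
fresh-edge a b = tabulate (proj₁ ∘ fresh-at)
               , at-tabulate (λ q c → c ≢ a at q) (proj₁ ∘ proj₂ ∘ fresh-at)
               , at-tabulate (λ q c → c ≢ b at q) (proj₂ ∘ proj₂ ∘ fresh-at)
  where
  fresh-at : ∀ q → ∃ λ c → c ≢ a at q × c ≢ b at q
  fresh-at q = fresh (a at q) (b at q)

-- Colourings without a rainbow loose path

module _ {n : ℕ} {A : Set} where

  NoRainbowLoosePath : (Edge n → A) → Set
  NoRainbowLoosePath χ = ∀ {a b d} → IsLoosePath a b d → ¬ Distinct₃ (χ a) (χ b) (χ d)

  RainbowLoosePath : (Edge n → A) → Set
  RainbowLoosePath χ = ∃ λ a → ∃ λ b → ∃ λ d → IsLoosePath a b d × Distinct₃ (χ a) (χ b) (χ d)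

  AtMostTwoColours : (Edge n → A) → Set
  AtMostTwoColours χ = ∃₂ λ α β → ∀ e → χ e ≡ α ⊎ χ e ≡ β

  ConstantOffAnEdge : (Edge n → A) → Set
  ConstantOffAnEdge χ = ∃₂ λ o α → ∀ w → Disjoint w o → χ w ≡ α

  rotate-noRainbow : ∀ {χ} → NoRainbowLoosePath χ → NoRainbowLoosePath (χ ∘ rotate)
  rotate-noRainbow nr ((i , a~b) , (j , b~d) , a∥d) =
    nr (rotate-meetsAt i a~b , rotate-meetsAt j b~d , rotate-disjoint a∥d)

  rainbowLoosePath? : DecidableEquality A → ∀ χ → Dec (RainbowLoosePath χ)
  rainbowLoosePath? _≟ᶜ_ χ = any-edge? λ a → any-edge? λ b → any-edge? λ d →
    isLoosePath? a b d ×-dec distinct₃? _≟ᶜ_ (χ a) (χ b) (χ d)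

module _ {A : Set} (_≟ᶜ_ : DecidableEquality A) where

  disjoint-triple-not-rainbow : ∀ {n} {χ : Edge n → A} → NoRainbowLoosePath χ → ∀ {x y v} →
    Disjoint x y → Disjoint v x → Disjoint v y → ¬ Distinct₃ (χ x) (χ v) (χ y)
  disjoint-triple-not-rainbow {n} {χ} nr {x} {y} {v} x∥y v∥x v∥y (X≢V , V≢Y , X≢Y) =
    nr ((-, meetsAt-sym w~y) , (-, w~v) , disjoint-sym v∥y)
       (subst (λ c → Distinct₃ (χ y) c (χ v)) (sym W≡X) (≢-sym X≢Y , X≢V , ≢-sym V≢Y))
    where
    w : Edge n
    w = x at 0F , y at 1F , v at 2F
    x~w : MeetsAt x w 0F
    x~w = meetsAt₀ refl (x∥y 1F) (≢-sym (v∥x 2F))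
    w~y : MeetsAt w y 1F
    w~y = meetsAt₁ (x∥y 0F) refl (v∥y 2F)
    w~v : MeetsAt w v 2F
    w~v = meetsAt₂ (≢-sym (v∥x 0F)) (≢-sym (v∥y 1F)) refl
    W≡X : χ w ≡ χ x
    W≡X = shared-alternative (≢-sym V≢Y)
      (¬distinct₃-middle _≟ᶜ_ (nr ((-, x~w) , (-, w~y) , x∥y)) X≢Y)
      (¬distinct₃-middle _≟ᶜ_ (nr ((-, x~w) , (-, w~v) , disjoint-sym v∥x)) X≢V)

  module _ {m : ℕ} where

    meets₀-disjoint-not-rainbow : ∀ {χ : Edge (3 + m) → A} → NoRainbowLoosePath χ → ∀ {x y v} →
      Disjoint x y → Disjoint v x → MeetsAt v y 0F → ¬ Distinct₃ (χ x) (χ v) (χ y)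
    meets₀-disjoint-not-rainbow {χ} nr {x} {y} {v} x∥y v∥x (v₀≡y₀ , v≁y) (X≢V , V≢Y , X≢Y) =
      U-neither (¬distinct₃-middle _≟ᶜ_ (nr ((-, x~u) , (-, u~y) , x∥y)) X≢Y)
      where
      p : ∃ λ c → c ≢ x at 0F × c ≢ y at 0F
      p = fresh (x at 0F) (y at 0F)
      u w : Edge (3 + m)
      u = proj₁ p , y at 1F , x at 2F
      w = x at 0F , y at 1F , v at 2F
      x~u : MeetsAt x u 2F
      x~u = meetsAt₂ (≢-sym (proj₁ (proj₂ p))) (x∥y 1F) refl
      u~y : MeetsAt u y 1F
      u~y = meetsAt₁ (proj₂ (proj₂ p)) refl (x∥y 2F)
      u∥v : Disjoint u v
      u∥v = λ { 0F u≡v → proj₂ (proj₂ p) (trans u≡v v₀≡y₀)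
              ; 1F → ≢-sym (v≁y 1F λ ())
              ; 2F → ≢-sym (v∥x 2F) }
      x~w : MeetsAt x w 0F
      x~w = meetsAt₀ refl (x∥y 1F) (≢-sym (v∥x 2F))
      w~y : MeetsAt w y 1F
      w~y = meetsAt₁ (x∥y 0F) refl (v≁y 2F λ ())
      w~v : MeetsAt w v 2F
      w~v = meetsAt₂ (≢-sym (v∥x 0F)) (≢-sym (v≁y 1F λ ())) refl
      u~w : MeetsAt u w 1F
      u~w = meetsAt₁ (proj₁ (proj₂ p)) refl (≢-sym (v∥x 2F))
      W≡X : χ w ≡ χ x
      W≡X = shared-alternative (≢-sym V≢Y)
        (¬distinct₃-middle _≟ᶜ_ (nr ((-, x~w) , (-, w~y) , x∥y)) X≢Y)
        (¬distinct₃-middle _≟ᶜ_ (nr ((-, x~w) , (-, w~v) , disjoint-sym v∥x)) X≢V)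
      U-neither : χ u ≡ χ x ⊎ χ u ≡ χ y → ⊥
      U-neither (inj₁ U≡X) = nr ((-, u~y) , (-, meetsAt-sym (v₀≡y₀ , v≁y)) , u∥v)
        (subst (λ c → Distinct₃ c (χ y) (χ v)) (sym U≡X) (X≢Y , ≢-sym V≢Y , X≢V))
      U-neither (inj₂ U≡Y) = nr ((-, u~w) , (-, w~v) , u∥v)
        (subst₂ (λ c c′ → Distinct₃ c c′ (χ v)) (sym U≡Y) (sym W≡X) (≢-sym X≢Y , X≢V , ≢-sym V≢Y))

    -- Rotating the coordinates once or twice moves the shared coordinate to 0; rotating three times
    -- is the identity up to η, so the colours of x, v and y are unchanged.
    meets-disjoint-not-rainbow : ∀ {χ : Edge (3 + m) → A} → NoRainbowLoosePath χ → ∀ {x y v i} →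
      Disjoint x y → Disjoint v x → MeetsAt v y i → ¬ Distinct₃ (χ x) (χ v) (χ y)
    meets-disjoint-not-rainbow nr {i = 0F} = meets₀-disjoint-not-rainbow nr
    meets-disjoint-not-rainbow nr {i = 1F} x∥y v∥x v~y =
      meets₀-disjoint-not-rainbow (rotate-noRainbow (rotate-noRainbow nr))
        (rotate-disjoint x∥y) (rotate-disjoint v∥x) (proj₂ (rotate-meetsAt 1F v~y))
    meets-disjoint-not-rainbow nr {i = 2F} x∥y v∥x v~y =
      meets₀-disjoint-not-rainbow (rotate-noRainbow nr)
        (rotate-disjoint (rotate-disjoint x∥y)) (rotate-disjoint (rotate-disjoint v∥x))
        (proj₂ (rotate-meetsAt 1F (proj₂ (rotate-meetsAt 2F v~y))))

    module _ {χ : Edge (3 + m) → A} (nr : NoRainbowLoosePath χ) where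

      far-colour : ∀ {x y v} → Disjoint x y → χ x ≢ χ y → Far v x → Far v y → χ v ≡ χ x ⊎ χ v ≡ χ y
      far-colour {x} {y} {v} x∥y X≢Y v⋯x v⋯y = ¬distinct₃-middle _≟ᶜ_ (not-rainbow v⋯x v⋯y) X≢Y
        where
        not-rainbow : Far v x → Far v y → ¬ Distinct₃ (χ x) (χ v) (χ y)
        not-rainbow (inj₁ v∥x)       (inj₁ v∥y)       = disjoint-triple-not-rainbow nr x∥y v∥x v∥y
        not-rainbow (inj₁ v∥x)       (inj₂ (_ , v~y)) = meets-disjoint-not-rainbow nr x∥y v∥x v~y
        not-rainbow (inj₂ (_ , v~x)) (inj₁ v∥y)       =
          meets-disjoint-not-rainbow nr (disjoint-sym x∥y) v∥y v~x ∘ distinct₃-reverse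
        not-rainbow (inj₂ (_ , v~x)) (inj₂ v~y)       = nr ((-, meetsAt-sym v~x) , v~y , x∥y)

      module ThirdColourCloseTo {x y z : Edge (3 + m)} (x∥y : Disjoint x y) (X≢Y : χ x ≢ χ y)
                                (Z-new : ¬ (χ z ≡ χ x ⊎ χ z ≡ χ y)) (z≈y : Close z y) where

        z-not-close : ∀ {w} → Disjoint w y → ¬ Close z w
        z-not-close w∥y z≈w = close-close-¬disjoint z≈y z≈w (disjoint-sym w∥y)

        disjoint-from-x-y⇒colour-x : ∀ {u} → Disjoint u x → Disjoint u y → χ u ≡ χ x
        disjoint-from-x-y⇒colour-x {u} u∥x u∥y with far-colour x∥y X≢Y (inj₁ u∥x) (inj₁ u∥y)
        ... | inj₁ U≡X = U≡X
        ... | inj₂ U≡Y = ⊥-elim (Z-new (⊎-map₂ (λ Z≡U → trans Z≡U U≡Y)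
          (far-colour (disjoint-sym u∥x) (λ X≡U → X≢Y (trans X≡U U≡Y))
                      (¬close⇒far (z-not-close x∥y)) (¬close⇒far (z-not-close u∥y)))))

        disjoint-from-y⇒colour-x-or-y : ∀ {w} → Disjoint w y → χ w ≡ χ x ⊎ χ w ≡ χ y
        disjoint-from-y⇒colour-x-or-y {w} w∥y with classify w x
        ... | inj₂ w⋯x = far-colour x∥y X≢Y w⋯x (inj₁ w∥y)
        ... | inj₁ w≈x with fresh-edge x y
        ...   | u , u∥x , u∥y = ⊎-map₁ (λ W≡U → trans W≡U U≡X)
          (far-colour u∥y (λ U≡Y → X≢Y (trans (sym U≡X) U≡Y))
                      (¬close⇒far λ w≈u → close-close-¬disjoint w≈x w≈u (disjoint-sym u∥x)) (inj₁ w∥y))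
          where
          U≡X : χ u ≡ χ x
          U≡X = disjoint-from-x-y⇒colour-x u∥x u∥y

        partner : ∃ λ r → χ r ≡ χ x × Disjoint r y × Disjoint r z
        partner with x at proj₁ z≈y ≟ z at proj₁ z≈y
        ... | no x≢z = x , refl , x∥y , disjoint-via-close z≈y x∥y x≢z
        ... | yes x≡z with fresh-edge x y
        ...   | u , u∥x , u∥y = u , disjoint-from-x-y⇒colour-x u∥x u∥y , u∥y
                              , disjoint-via-close z≈y u∥y (λ u≡z → u∥x (proj₁ z≈y) (trans u≡z (sym x≡z)))

        colour-y⇒close-to-partner : ∀ {w} → Disjoint w y → χ w ≡ χ y → Close w (proj₁ partner)
        colour-y⇒close-to-partner {w} w∥y W≡Y with partner | classify w (proj₁ partner)
        ... | _ , _ , _ , _     | inj₁ w≈r = w≈r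
        ... | r , R≡X , _ , r∥z | inj₂ w⋯r = ⊥-elim
          ([ (λ W≡Z → Z-new (inj₂ (trans (sym W≡Z) W≡Y)))
           , (λ W≡R → X≢Y (trans (sym R≡X) (trans (sym W≡R) W≡Y))) ]′
           (far-colour (disjoint-sym r∥z) (λ Z≡R → Z-new (inj₁ (trans Z≡R R≡X)))
                       (¬close⇒far (z-not-close w∥y ∘ close-sym)) w⋯r))

        -- If χ w = χ y, take w′ disjoint from y and w: if χ w′ = χ x then z is far from the disjoint
        -- pair w, w′ of colours χ y, χ x; if χ w′ = χ y then w and w′ are both close to the partner.
        disjoint-from-y⇒colour-x : ∀ w → Disjoint w y → χ w ≡ χ x
        disjoint-from-y⇒colour-x w w∥y with disjoint-from-y⇒colour-x-or-y w∥y
        ... | inj₁ W≡X = W≡X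
        ... | inj₂ W≡Y with fresh-edge y w
        ...   | w′ , w′∥y , w′∥w with disjoint-from-y⇒colour-x-or-y w′∥y
        ...     | inj₁ W′≡X = ⊥-elim (Z-new
          ([ (λ Z≡W → inj₂ (trans Z≡W W≡Y)) , (λ Z≡W′ → inj₁ (trans Z≡W′ W′≡X)) ]′
           (far-colour (disjoint-sym w′∥w) (λ W≡W′ → X≢Y (trans (sym W′≡X) (trans (sym W≡W′) W≡Y)))
                       (¬close⇒far (z-not-close w∥y)) (¬close⇒far (z-not-close w′∥y)))))
        ...     | inj₂ W′≡Y = ⊥-elim (close-close-¬disjoint
          (close-sym (colour-y⇒close-to-partner w∥y W≡Y))
          (close-sym (colour-y⇒close-to-partner w′∥y W′≡Y))
          (disjoint-sym w′∥w))

      structure-from-disjoint-pair : ∀ {x y} → Disjoint x y → χ x ≢ χ y →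
                                     AtMostTwoColours χ ⊎ ConstantOffAnEdge χ
      structure-from-disjoint-pair {x} {y} x∥y X≢Y with any-edge? (λ z → ¬? (χ z ≟ᶜ χ x ⊎-dec χ z ≟ᶜ χ y))
      ... | no ¬new = inj₁ (χ x , χ y , λ e → decidable-stable (χ e ≟ᶜ χ x ⊎-dec χ e ≟ᶜ χ y) (¬new ∘ (e ,_)))
      ... | yes (z , Z-new) with classify z y | classify z x
      ...   | inj₁ z≈y | _ = inj₂ (y , χ x , ThirdColourCloseTo.disjoint-from-y⇒colour-x x∥y X≢Y Z-new z≈y)
      ...   | inj₂ _   | inj₁ z≈x = inj₂ (x , χ y ,
        ThirdColourCloseTo.disjoint-from-y⇒colour-x (disjoint-sym x∥y) (≢-sym X≢Y) (Z-new ∘ swap) z≈x)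
      ...   | inj₂ z⋯y | inj₂ z⋯x = ⊥-elim (Z-new (far-colour x∥y X≢Y z⋯x z⋯y))

      private
        origin : Edge (3 + m)
        origin = 0F , 0F , 0F

      noRainbow-structure : AtMostTwoColours χ ⊎ ConstantOffAnEdge χ
      noRainbow-structure with any-edge? (λ e → ¬? (χ e ≟ᶜ χ origin))
      ... | no ¬other = inj₁ (χ origin , χ origin , λ e →
        inj₁ (decidable-stable (χ e ≟ᶜ χ origin) (¬other ∘ (e ,_))))
      ... | yes (g , G≢O) with fresh-edge g origin
      ...   | h , h∥g , h∥o with χ h ≟ᶜ χ origin
      ...     | yes H≡O = structure-from-disjoint-pair h∥g (λ H≡G → G≢O (trans (sym H≡G) H≡O))
      ...     | no H≢O  = structure-from-disjoint-pair h∥o H≢O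

-- Copies and the colours of their edges

pick-satisfies : ∀ {n} (P : Vtx n → Set) {x y z : Vtx n} → Distinct₃ (proj₁ x) (proj₁ y) (proj₁ z) →
                 P x → P y → P z → ∀ p → P (p , pick p x y z)
pick-satisfies P {x} {y} {z} parts Px Py Pz p with proj₁ x ≟ p
... | yes refl = Px
... | no x≢p with proj₁ y ≟ p
...   | yes refl = Py
...   | no y≢p   = subst (λ q → P (q , proj₂ z)) (distinct₃-Fin3-remaining parts x≢p y≢p) Pz

module _ {H : 3Graph} {n : ℕ} (φ : Copy H n) where

  -- edgeColor col φ e is definitionally colourOf col (image e).
  image : Fin (nE H) → Edge n
  image e = let (a , b , c) = edge H e in tabulate λ p → pick p (emb φ a) (emb φ b) (emb φ c)

  image-satisfies : ∀ (P : Vtx n → Set) e → let (a , b , c) = edge H e in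
                    P (emb φ a) → P (emb φ b) → P (emb φ c) → ∀ p → P (p , image e at p)
  image-satisfies P e Pa Pb Pc = at-tabulate (λ q i → P (q , i)) (pick-satisfies P (tran φ e) Pa Pb Pc)

  image-≡ : ∀ {a} e → let (u , v , w) = edge H e in
            emb φ u ∈ₑ a → emb φ v ∈ₑ a → emb φ w ∈ₑ a → image e ≡ a
  image-≡ {a} e u∈a v∈a w∈a = edge-ext (image-satisfies (_∈ₑ a) e u∈a v∈a w∈a)

module _ {m : ℕ} {A : Set} (col : Coloring (3 + m) A) where

  rainbow-loosePath-copy : ∀ {a b d} → IsLoosePath a b d →
    Distinct₃ (colourOf col a) (colourOf col b) (colourOf col d) → RainbowCopy LoosePath col
  rainbow-loosePath-copy {a} {b} {d} ((i , a~b) , (j , b~d) , a∥d) rainbow = φ , edges-rainbow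
    where
    i≢j : i ≢ j
    i≢j refl = a∥d i (trans (proj₁ a~b) (proj₁ b~d))
    k : Fin 3
    k = proj₁ (fresh {0} i j)
    k≢i : k ≢ i
    k≢i = proj₁ (proj₂ (fresh {0} i j))
    k≢j : k ≢ j
    k≢j = proj₂ (proj₂ (fresh {0} i j))

    -- Vertex u of 𝓛 lies in part `part c` with index `index c r`, where (c , r) = label u; the
    -- classes 0, 1, 2 are the part i of a ∩ b, the part j of b ∩ d and the remaining part k.
    part : Fin 3 → Fin 3
    part = i ∷ j ∷ k ∷ []

    index : Fin 3 → Fin 3 → Fin (3 + m)
    index 0F = pad (a at i) (d at i)
    index 1F = pad (a at j) (b at j)
    index 2F = a at k ∷ b at k ∷ d at k ∷ []

    label : Fin 7 → Fin 3 × Fin 3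
    label = (1F , 0F) ∷ (2F , 0F) ∷ (0F , 0F) ∷ (2F , 1F) ∷ (1F , 1F) ∷ (0F , 1F) ∷ (2F , 2F) ∷ []

    place : Fin 3 × Fin 3 → Vtx (3 + m)
    place (c , r) = part c , index c r

    index-injective : ∀ c → Injective _≡_ _≡_ (index c)
    index-injective 0F = pad-injective (a∥d i)
    index-injective 1F = pad-injective (proj₂ a~b j (≢-sym i≢j))
    index-injective 2F = distinct₃-injective (proj₂ a~b k k≢i , proj₂ b~d k k≢j , a∥d k)

    place-injective : Injective _≡_ _≡_ place
    place-injective {c , r} {c′ , r′} eq
      with distinct₃-injective (i≢j , ≢-sym k≢j , ≢-sym k≢i) {c} {c′} (cong proj₁ eq)
    ... | refl = cong (c ,_) (index-injective c (cong proj₂ eq))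

    label-injective : Injective _≡_ _≡_ label
    label-injective {u} {v} =
      toWitness {a? = all? λ u → all? λ v → ≡-dec _≟_ _≟_ (label u) (label v) →-dec u ≟ v} _ u v

    φ : Copy LoosePath (3 + m)
    φ = record
      { emb  = place ∘ label
      ; inj  = label-injective ∘ place-injective
      ; tran = λ { 0F → ≢-sym k≢j , k≢i , ≢-sym i≢j
                 ; 1F → ≢-sym k≢i , k≢j , i≢j
                 ; 2F → ≢-sym i≢j , ≢-sym k≢i , ≢-sym k≢j } }

    edge-colour : ∀ e → edgeColor col φ e ≡ (colourOf col a ∷ colourOf col b ∷ colourOf col d ∷ []) e
    edge-colour 0F = cong (colourOf col) (image-≡ φ 0F refl refl refl)
    edge-colour 1F = cong (colourOf col) (image-≡ φ 1F (proj₁ a~b) refl refl)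
    edge-colour 2F = cong (colourOf col) (image-≡ φ 2F (proj₁ b~d) refl refl)

    edges-rainbow : ∀ e e′ → e ≢ e′ → edgeColor col φ e ≢ edgeColor col φ e′
    edges-rainbow e e′ e≢e′ same =
      e≢e′ (distinct₃-injective rainbow (trans (sym (edge-colour e)) (trans same (edge-colour e′))))

module _ {t n : ℕ} (o : Edge (ℕ.suc n)) (t≤n : t ≤ n) where

  avoid : Vtx t → Vtx (ℕ.suc n)
  avoid (q , x) = q , punchIn (o at q) (inject≤ x t≤n)

  avoid-∉ : ∀ v → avoid v ∉ₑ o
  avoid-∉ (q , x) = punchInᵢ≢i (o at q) (inject≤ x t≤n)

  avoid-injective : Injective _≡_ _≡_ avoid
  avoid-injective {q , x} {q′ , x′} eq with cong proj₁ eq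
  ... | refl = cong (q ,_) (inject≤-injective t≤n t≤n x x′ (punchIn-injective (o at q) _ _ (cong proj₂ eq)))

  copy-avoiding : ∀ {H} → Copy H t → Copy H (ℕ.suc n)
  copy-avoiding ψ = record { emb = avoid ∘ emb ψ ; inj = inj ψ ∘ avoid-injective ; tran = tran ψ }

monoCopy-constantOffAnEdge : ∀ {H t n} {A : Set} → Copy H t → t ≤ n → (col : Coloring (ℕ.suc n) A) →
                             ConstantOffAnEdge (colourOf col) → MonoCopy H col
monoCopy-constantOffAnEdge {H} {t} {n} ψ t≤n col (o , α , off) =
  φ , α , λ e → off (image φ e) (image-disjoint e)
  where
  φ : Copy H (ℕ.suc n)
  φ = copy-avoiding o t≤n ψ
  avoids : ∀ v → avoid o t≤n (emb ψ v) ∉ₑ o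
  avoids v = avoid-∉ o t≤n (emb ψ v)
  image-disjoint : ∀ e → Disjoint (image φ e) o
  image-disjoint e = image-satisfies φ (_∉ₑ o) e (avoids _) (avoids _) (avoids _)

module _ {A : Set} (_≟ᶜ_ : DecidableEquality A) where

  indicator : A → A → Fin 2
  indicator α c with c ≟ᶜ α
  ... | yes _ = 0F
  ... | no _  = 1F

  indicator≡0 : ∀ {α c} → indicator α c ≡ 0F → c ≡ α
  indicator≡0 {α} {c} with c ≟ᶜ α
  ... | yes c≡α = λ _ → c≡α
  ... | no _    = λ ()

  indicator≡1 : ∀ {α c} → indicator α c ≡ 1F → c ≢ α
  indicator≡1 {α} {c} with c ≟ᶜ α
  ... | yes _  = λ ()
  ... | no c≢α = λ _ → c≢α

  monoCopy-atMostTwoColours : ∀ {H n} → Ramsey2 H n → (col : Coloring n A) →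
                              AtMostTwoColours (colourOf col) → MonoCopy H col
  monoCopy-atMostTwoColours ramsey col (α , β , two) with ramsey (λ x y z → indicator α (col x y z))
  ... | φ , 0F , mono = φ , α , λ e → indicator≡0 (mono e)
  ... | φ , 1F , mono = φ , β , λ e → [ ⊥-elim ∘ indicator≡1 (mono e) , id ]′ (two (image φ e))

-- Ramsey numbers

monoCopy-retract : ∀ {H n} {B C : Set} {col : Coloring n B} (f : B → C) (g : C → B) →
                   (∀ b → g (f b) ≡ b) → MonoCopy H (λ x y z → f (col x y z)) → MonoCopy H col
monoCopy-retract f g g∘f≡id (φ , c , mono) = φ , g c , λ e → trans (sym (g∘f≡id _)) (cong g (mono e))

fr⇒ramsey : ∀ {H n} → FR H LoosePath n → Ramsey2 H n
fr⇒ramsey {H} {n} fr col =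
  [ monoCopy-retract {col = col} toℕ fromℕ fromℕ∘toℕ , ⊥-elim ∘ no-rainbow ]′ (fr (λ x y z → toℕ (col x y z)))
  where
  fromℕ : ℕ → Fin 2
  fromℕ ℕ.zero    = 0F
  fromℕ (ℕ.suc _) = 1F
  fromℕ∘toℕ : ∀ b → fromℕ (toℕ b) ≡ b
  fromℕ∘toℕ 0F = refl
  fromℕ∘toℕ 1F = refl
  no-rainbow : ¬ RainbowCopy LoosePath (λ x y z → toℕ (col x y z))
  no-rainbow (_ , rb) = ¬distinct₃-Fin2 _ _ _
    (rb 0F 1F (λ ()) ∘ cong toℕ , rb 1F 2F (λ ()) ∘ cong toℕ , rb 0F 2F (λ ()) ∘ cong toℕ)

ramsey-trivial : ∀ {H n} → n ≤ 1 → Copy H n → Ramsey2 H n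
ramsey-trivial {H} {ℕ.zero} _ ψ col = ψ , 0F , λ e → ⊥-elim (¬Fin0 (proj₂ (emb ψ (proj₁ (edge H e)))))
ramsey-trivial {n = ℕ.suc ℕ.zero} _ ψ col = ψ , col 0F 0F 0F , λ e → constant _ _ _
  where
  constant : ∀ x y z → col x y z ≡ col 0F 0F 0F
  constant 0F 0F 0F = refl
ramsey-trivial {n = ℕ.suc (ℕ.suc _)} (s≤s ()) _

ramsey⇒fr : ∀ {H t m} → Copy H t → t ≤ 2 + m → Ramsey2 H (3 + m) → FR H LoosePath (3 + m)
ramsey⇒fr {H} ψ t≤ ramsey col = from-dec (rainbowLoosePath? ℕ._≟_ (colourOf col))
  where
  from-structure : AtMostTwoColours (colourOf col) ⊎ ConstantOffAnEdge (colourOf col) → MonoCopy H col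
  from-structure (inj₁ two-colours) = monoCopy-atMostTwoColours ℕ._≟_ ramsey col two-colours
  from-structure (inj₂ off-edge)    = monoCopy-constantOffAnEdge ψ t≤ col off-edge

  from-dec : Dec (RainbowLoosePath (colourOf col)) → MonoCopy H col ⊎ RainbowCopy LoosePath col
  from-dec (yes (_ , _ , _ , path , rainbow)) = inj₂ (rainbow-loosePath-copy col path rainbow)
  from-dec (no ¬rainbow) = inj₁ (from-structure
    (noRainbow-structure ℕ._≟_ λ path rainbow → ¬rainbow (_ , _ , _ , path , rainbow)))

least-ramsey⇒fr : ∀ {H t r} → Copy H t → Ramsey2 H r → (∀ k → Ramsey2 H k → r ≤ k) → t < r →
                  FR H LoosePath r
least-ramsey⇒fr {t = 0} ψ _ least t<r = ⊥-elim (<⇒≱ t<r (least 0 (ramsey-trivial z≤n ψ)))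
least-ramsey⇒fr {t = 1} ψ _ least t<r = ⊥-elim (<⇒≱ t<r (least 1 (ramsey-trivial ≤-refl ψ)))
least-ramsey⇒fr {t = ℕ.suc (ℕ.suc _)} {r = ℕ.suc (ℕ.suc (ℕ.suc _))} ψ ramsey _ (s≤s t≤) =
  ramsey⇒fr ψ t≤ ramsey
least-ramsey⇒fr {t = ℕ.suc (ℕ.suc _)} {r = 0} _ _ _ ()
least-ramsey⇒fr {t = ℕ.suc (ℕ.suc _)} {r = 1} _ _ _ (s≤s ())
least-ramsey⇒fr {t = ℕ.suc (ℕ.suc _)} {r = 2} _ _ _ (s≤s (s≤s ()))

theorem1p18 : (H : 3Graph) → Is3Partite H → (t r : ℕ) →
    IsLeast (Fits H) t → IsLeast (Ramsey2 H) r → t + 1 ≤ r →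
    IsLeast (FR H LoosePath) r
theorem1p18 H _ t r (ψ , _) (ramsey , least) t+1≤r =
  least-ramsey⇒fr ψ ramsey least (subst (_≤ r) (+-comm t 1) t+1≤r) , λ k fr → least k (fr⇒ramsey fr)
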